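{- For every $n\in\{0,1,2,\dots\}$, \[ b_n=\frac{1}{n!}\sum_{k=0}^n\sum_{m=0}^k(-1)^m\binom{k}{m}\frac{s(n+m,m)}{\binom{n+m}{m}} =\frac{1}{n!}\sum_{m=0}^n(-1)^m \binom{n+1}{m+1}\frac{s(n+m,m)}{\binom{n+m}{m}}. \]
   Context: The Bernoulli numbers of the second kind $b_n$ are defined by $\frac{x}{\ln(1+x)}=\sum_{n=0}^\infty b_nx^n$ for $|x|<1$. $s(n,k)$ denotes the signed Stirling numbers of the first kind, defined by $\lambda(\lambda-1)\cdots(\lambda-n+1)=\sum_{k=0}^n s(n,k)\lambda^k$. -}

module Defs where

open import Data.Nat as ℕ using (ℕ; zero; suc; _∸_; _!)
open import Data.Nat.Combinatorics using (_C_)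
open import Data.Integer as ℤ using (ℤ; +_)
open import Data.Rational using (ℚ; 0ℚ; 1ℚ; _+_; _*_; -_; _/_)

sumTo : ℕ → (ℕ → ℚ) → ℚ
sumTo zero    f = f zero
sumTo (suc n) f = sumTo n f + f (suc n)

neg1^ : ℕ → ℚ
neg1^ zero    = 1ℚ
neg1^ (suc m) = - neg1^ m

ℕ→ℚ : ℕ → ℚ
ℕ→ℚ n = + n / 1

ℤ→ℚ : ℤ → ℚ
ℤ→ℚ z = z / 1

-- 1/d for d ≥ 1 (value at 0 is a junk 0; only applied to positive numbers)
recip : ℕ → ℚ
recip zero    = 0ℚ
recip (suc k) = + 1 / suc k

-- signed Stirling numbers of the first kind s(n,k):
-- coefficients of λ(λ-1)⋯(λ-n+1); the recursion is multiplication by (λ - n).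
stirling1 : ℕ → ℕ → ℤ
stirling1 zero    zero    = + 1
stirling1 zero    (suc k) = + 0
stirling1 (suc n) zero    = + 0
stirling1 (suc n) (suc k) = stirling1 n k ℤ.- (+ n) ℤ.* stirling1 n (suc k)

-- coefficients of the power series ln(1+x)/x = Σ (-1)^j x^j / (j+1)
logCoeff : ℕ → ℚ
logCoeff j = neg1^ j * recip (suc j)

delta0 : ℕ → ℚ
delta0 zero    = 1ℚ
delta0 (suc n) = 0ℚ

-- b is the coefficient sequence of x / ln(1+x), i.e. the (formal power series)
-- reciprocal of ln(1+x)/x:  (Σ b_n x^n)·(ln(1+x)/x) = 1.
IsBernoulli2 : (ℕ → ℚ) → Set
IsBernoulli2 b = ∀ n → sumTo n (λ k → b k * logCoeff (n ∸ k)) ≡ delta0 n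
  where open import Relation.Binary.PropositionalEquality using (_≡_)

term : ℕ → ℕ → ℚ
term n m = ℤ→ℚ (stirling1 (n ℕ.+ m) m) * recip ((n ℕ.+ m) C m)

firstFormula : ℕ → ℚ
firstFormula n = recip (n !) *
  sumTo n (λ k → sumTo k (λ m → neg1^ m * ℕ→ℚ (k C m) * term n m))

secondFormula : ℕ → ℚ
secondFormula n = recip (n !) *
  sumTo n (λ m → neg1^ m * ℕ→ℚ (suc n C suc m) * term n m)

-- Let L = ln(1+x)/x. The number m! s(n+m,m)/(n+m)! is the coefficient of x^n in L^m: multiplying by L
-- raises m, as one sees by applying (1 + x)(x d/dx + m + 1) to both sides and using the Leibniz rule,
-- (1 + x)(x L)' = 1 and the Stirling recursion. As L has constant term 1, b = 1/L = Σ_k (1 - L)^k, where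
-- (1 - L)^k = Σ_{m≤k} (-1)^m C(k,m) L^m vanishes below degree k; so b_n is the double sum over k ≤ n, and
-- summing over k first by Pascal's rule (the hockey stick identity) gives the second formula.
module Submission where

open import Defs
open import Data.Nat using (ℕ)
open import Data.Rational using (ℚ)
open import Data.Product using (_×_)
open import Relation.Binary.PropositionalEquality using (_≡_)

open import Data.Nat as ℕ using (zero; suc; _∸_; _!; _≤_; _<_; z≤n; s≤s; NonZero)
import Data.Nat.Properties as ℕP
open import Data.Nat.Induction using (<-rec)
open import Algebra.Properties.CommutativeSemigroup ℕP.+-commutativeSemigroup using () renaming (interchange to +-interchange)
open import Data.Nat.Combinatorics using (_C_; nCk+nC[k+1]≡[n+1]C[k+1]; k![n∸k]!∣n!)
open import Data.Nat.Combinatorics.Specification using (nCk≡n!/k![n-k]!; k>n⇒nCk≡0)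
open import Data.Nat.DivMod using (m/n*n≡m)
import Data.Integer as ℤ
open import Data.Integer using (ℤ)
import Data.Integer.Properties as ℤP
open import Data.Rational using (0ℚ; 1ℚ; _+_; _*_; -_; _-_; fromℚᵘ)
open import Data.Rational.Properties
import Data.Rational.Unnormalised as ℚᵘ
import Data.Rational.Unnormalised.Properties as ℚᵘP
open import Algebra.Properties.Group +-0-group using (∙-cancelˡ; ∙-cancelʳ)
open import Data.Rational.Solver using (module +-*-Solver)
open +-*-Solver
open import Data.Product using (_,_)
open import Relation.Binary.PropositionalEquality using (refl; sym; trans; cong; cong₂; subst; module ≡-Reasoning)

fromℚᵘ-homo-+ : ∀ p q → fromℚᵘ (p ℚᵘ.+ q) ≡ fromℚᵘ p + fromℚᵘ q
fromℚᵘ-homo-+ p q = toℚᵘ-injective (ℚᵘP.≃-trans (toℚᵘ-fromℚᵘ (p ℚᵘ.+ q))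
  (ℚᵘP.≃-sym (ℚᵘP.≃-trans (toℚᵘ-homo-+ (fromℚᵘ p) (fromℚᵘ q)) (ℚᵘP.+-cong (toℚᵘ-fromℚᵘ p) (toℚᵘ-fromℚᵘ q)))))

fromℚᵘ-homo-* : ∀ p q → fromℚᵘ (p ℚᵘ.* q) ≡ fromℚᵘ p * fromℚᵘ q
fromℚᵘ-homo-* p q = toℚᵘ-injective (ℚᵘP.≃-trans (toℚᵘ-fromℚᵘ (p ℚᵘ.* q))
  (ℚᵘP.≃-sym (ℚᵘP.≃-trans (toℚᵘ-homo-* (fromℚᵘ p) (fromℚᵘ q)) (ℚᵘP.*-cong (toℚᵘ-fromℚᵘ p) (toℚᵘ-fromℚᵘ q)))))

fromℚᵘ-homo‿- : ∀ p → fromℚᵘ (ℚᵘ.- p) ≡ - fromℚᵘ p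
fromℚᵘ-homo‿- p = toℚᵘ-injective (ℚᵘP.≃-trans (toℚᵘ-fromℚᵘ (ℚᵘ.- p))
  (ℚᵘP.≃-sym (ℚᵘP.≃-trans (toℚᵘ-homo‿- (fromℚᵘ p)) (ℚᵘP.-‿cong (toℚᵘ-fromℚᵘ p)))))

ℤ→ℚ-homo-+ : ∀ a b → ℤ→ℚ (a ℤ.+ b) ≡ ℤ→ℚ a + ℤ→ℚ b
ℤ→ℚ-homo-+ a b = trans
  (fromℚᵘ-cong {ℚᵘ.mkℚᵘ (a ℤ.+ b) 0} {ℚᵘ.mkℚᵘ a 0 ℚᵘ.+ ℚᵘ.mkℚᵘ b 0} (ℚᵘ.*≡* denominators-one))
  (fromℚᵘ-homo-+ (ℚᵘ.mkℚᵘ a 0) (ℚᵘ.mkℚᵘ b 0))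
  where
  denominators-one : (a ℤ.+ b) ℤ.* ℤ.+ 1 ≡ (a ℤ.* ℤ.+ 1 ℤ.+ b ℤ.* ℤ.+ 1) ℤ.* ℤ.+ 1
  denominators-one = trans (ℤP.*-identityʳ _)
    (sym (trans (ℤP.*-identityʳ _) (cong₂ ℤ._+_ (ℤP.*-identityʳ a) (ℤP.*-identityʳ b))))

ℤ→ℚ-homo-* : ∀ a b → ℤ→ℚ (a ℤ.* b) ≡ ℤ→ℚ a * ℤ→ℚ b
ℤ→ℚ-homo-* a b = trans
  (fromℚᵘ-cong {ℚᵘ.mkℚᵘ (a ℤ.* b) 0} {ℚᵘ.mkℚᵘ a 0 ℚᵘ.* ℚᵘ.mkℚᵘ b 0} (ℚᵘ.*≡* refl))
  (fromℚᵘ-homo-* (ℚᵘ.mkℚᵘ a 0) (ℚᵘ.mkℚᵘ b 0))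

ℤ→ℚ-homo-- : ∀ a b → ℤ→ℚ (a ℤ.- b) ≡ ℤ→ℚ a - ℤ→ℚ b
ℤ→ℚ-homo-- a b = trans (ℤ→ℚ-homo-+ a (ℤ.- b)) (cong (λ t → ℤ→ℚ a + t) (fromℚᵘ-homo‿- (ℚᵘ.mkℚᵘ b 0)))

ℕ→ℚ-homo-+ : ∀ m n → ℕ→ℚ (m ℕ.+ n) ≡ ℕ→ℚ m + ℕ→ℚ n
ℕ→ℚ-homo-+ m n = trans (cong ℤ→ℚ (ℤP.pos-+ m n)) (ℤ→ℚ-homo-+ (ℤ.+ m) (ℤ.+ n))

ℕ→ℚ-homo-* : ∀ m n → ℕ→ℚ (m ℕ.* n) ≡ ℕ→ℚ m * ℕ→ℚ n
ℕ→ℚ-homo-* m n = trans (cong ℤ→ℚ (ℤP.pos-* m n)) (ℤ→ℚ-homo-* (ℤ.+ m) (ℤ.+ n))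

recip-homo-* : ∀ a b → recip (a ℕ.* b) ≡ recip a * recip b
recip-homo-* zero    b = sym (*-zeroˡ (recip b))
recip-homo-* (suc a) zero rewrite ℕP.*-zeroʳ a = sym (*-zeroʳ (recip (suc a)))
recip-homo-* (suc a) (suc b) = fromℚᵘ-homo-* (ℚᵘ.mkℚᵘ (ℤ.+ 1) a) (ℚᵘ.mkℚᵘ (ℤ.+ 1) b)

ℕ→ℚ-*-recip : ∀ n .{{_ : NonZero n}} → ℕ→ℚ n * recip n ≡ 1ℚ
ℕ→ℚ-*-recip (suc k) = trans (sym (fromℚᵘ-homo-* (ℚᵘ.mkℚᵘ (ℤ.+ suc k) 0) (ℚᵘ.mkℚᵘ (ℤ.+ 1) k)))
  (fromℚᵘ-cong {ℚᵘ.mkℚᵘ (ℤ.+ suc k) 0 ℚᵘ.* ℚᵘ.mkℚᵘ (ℤ.+ 1) k} {ℚᵘ.mkℚᵘ (ℤ.+ 1) 0} (ℚᵘ.*≡* cross))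
  where
  cross : (ℤ.+ suc k ℤ.* ℤ.+ 1) ℤ.* ℤ.+ 1 ≡ ℤ.+ 1 ℤ.* ℤ.+ (1 ℕ.* suc k)
  cross = trans (ℤP.*-identityʳ _) (trans (ℤP.*-identityʳ _)
    (sym (trans (ℤP.*-identityˡ _) (cong ℤ.+_ (ℕP.*-identityˡ (suc k))))))

ℕ→ℚ-*-recip-cancelˡ : ∀ x y .{{_ : NonZero x}} → ℕ→ℚ x * recip (x ℕ.* y) ≡ recip y
ℕ→ℚ-*-recip-cancelˡ x y = begin
  ℕ→ℚ x * recip (x ℕ.* y)      ≡⟨ cong (ℕ→ℚ x *_) (recip-homo-* x y) ⟩
  ℕ→ℚ x * (recip x * recip y)  ≡⟨ *-assoc (ℕ→ℚ x) (recip x) (recip y) ⟨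
  ℕ→ℚ x * recip x * recip y    ≡⟨ cong (_* recip y) (ℕ→ℚ-*-recip x) ⟩
  1ℚ * recip y                 ≡⟨ *-identityˡ (recip y) ⟩
  recip y                      ∎
  where open ≡-Reasoning

ℕ→ℚ-*-cancelˡ : ∀ k {x y} .{{_ : NonZero k}} → ℕ→ℚ k * x ≡ ℕ→ℚ k * y → x ≡ y
ℕ→ℚ-*-cancelˡ k {x} {y} eq = begin
  x                        ≡⟨ *-identityˡ x ⟨
  1ℚ * x                   ≡⟨ cong (_* x) (sym recip-*-ℕ→ℚ) ⟩
  recip k * ℕ→ℚ k * x      ≡⟨ *-assoc (recip k) (ℕ→ℚ k) x ⟩
  recip k * (ℕ→ℚ k * x)    ≡⟨ cong (recip k *_) eq ⟩
  recip k * (ℕ→ℚ k * y)    ≡⟨ *-assoc (recip k) (ℕ→ℚ k) y ⟨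
  recip k * ℕ→ℚ k * y      ≡⟨ cong (_* y) recip-*-ℕ→ℚ ⟩
  1ℚ * y                   ≡⟨ *-identityˡ y ⟩
  y                        ∎
  where
  open ≡-Reasoning
  recip-*-ℕ→ℚ : recip k * ℕ→ℚ k ≡ 1ℚ
  recip-*-ℕ→ℚ = trans (*-comm (recip k) (ℕ→ℚ k)) (ℕ→ℚ-*-recip k)

sumTo-cong≤ : ∀ n {f g : ℕ → ℚ} → (∀ j → j ≤ n → f j ≡ g j) → sumTo n f ≡ sumTo n g
sumTo-cong≤ zero    eq = eq 0 z≤n
sumTo-cong≤ (suc n) eq = cong₂ _+_ (sumTo-cong≤ n (λ j j≤n → eq j (ℕP.m≤n⇒m≤1+n j≤n))) (eq (suc n) ℕP.≤-refl)

sumTo-cong : ∀ n {f g : ℕ → ℚ} → (∀ j → f j ≡ g j) → sumTo n f ≡ sumTo n g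
sumTo-cong n eq = sumTo-cong≤ n (λ j _ → eq j)

sumTo-zero : ∀ n (f : ℕ → ℚ) → (∀ j → j ≤ n → f j ≡ 0ℚ) → sumTo n f ≡ 0ℚ
sumTo-zero zero    f eq = eq 0 z≤n
sumTo-zero (suc n) f eq = cong₂ _+_ (sumTo-zero n f (λ j j≤n → eq j (ℕP.m≤n⇒m≤1+n j≤n))) (eq (suc n) ℕP.≤-refl)

sumTo-+ : ∀ n (f g : ℕ → ℚ) → sumTo n (λ j → f j + g j) ≡ sumTo n f + sumTo n g
sumTo-+ zero    f g = refl
sumTo-+ (suc n) f g = trans (cong (_+ (f (suc n) + g (suc n))) (sumTo-+ n f g))
  (solve 4 (λ a b c d → (a :+ b) :+ (c :+ d) := (a :+ c) :+ (b :+ d)) refl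
     (sumTo n f) (sumTo n g) (f (suc n)) (g (suc n)))

sumTo-- : ∀ n (f g : ℕ → ℚ) → sumTo n (λ j → f j - g j) ≡ sumTo n f - sumTo n g
sumTo-- zero    f g = refl
sumTo-- (suc n) f g = trans (cong (_+ (f (suc n) - g (suc n))) (sumTo-- n f g))
  (solve 4 (λ a b c d → (a :- b) :+ (c :- d) := (a :+ c) :- (b :+ d)) refl
     (sumTo n f) (sumTo n g) (f (suc n)) (g (suc n)))

sumTo-*ˡ : ∀ n c (f : ℕ → ℚ) → c * sumTo n f ≡ sumTo n (λ j → c * f j)
sumTo-*ˡ zero    c f = refl
sumTo-*ˡ (suc n) c f = trans (*-distribˡ-+ c (sumTo n f) (f (suc n))) (cong (_+ c * f (suc n)) (sumTo-*ˡ n c f))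

sumTo-*ʳ : ∀ n c (f : ℕ → ℚ) → sumTo n f * c ≡ sumTo n (λ j → f j * c)
sumTo-*ʳ n c f = trans (*-comm (sumTo n f) c) (trans (sumTo-*ˡ n c f) (sumTo-cong n (λ j → *-comm c (f j))))

sumTo-unshift : ∀ n (f : ℕ → ℚ) → sumTo (suc n) f ≡ f 0 + sumTo n (λ j → f (suc j))
sumTo-unshift zero    f = refl
sumTo-unshift (suc n) f = trans (cong (_+ f (suc (suc n))) (sumTo-unshift n f)) (+-assoc (f 0) _ _)

sumTo-last-zero : ∀ n (f : ℕ → ℚ) → f (suc n) ≡ 0ℚ → sumTo (suc n) f ≡ sumTo n f
sumTo-last-zero n f eq = trans (cong (λ t → sumTo n f + t) eq) (+-identityʳ (sumTo n f))

sumTo-comm : ∀ a b (f : ℕ → ℕ → ℚ) →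
  sumTo a (λ i → sumTo b (λ j → f i j)) ≡ sumTo b (λ j → sumTo a (λ i → f i j))
sumTo-comm zero    b f = refl
sumTo-comm (suc a) b f = trans (cong (_+ sumTo b (f (suc a))) (sumTo-comm a b f))
  (sym (sumTo-+ b (λ j → sumTo a (λ i → f i j)) (f (suc a))))

sumTo-telescope : ∀ n (f : ℕ → ℚ) → sumTo n (λ k → f k - f (suc k)) ≡ f 0 - f (suc n)
sumTo-telescope zero    f = refl
sumTo-telescope (suc n) f = trans (cong (_+ (f (suc n) - f (suc (suc n)))) (sumTo-telescope n f))
  (solve 3 (λ a b c → (a :- b) :+ (b :- c) := a :- c) refl (f 0) (f (suc n)) (f (suc (suc n))))

-- Convolution of coefficient sequences

infixl 7 _⋆_

_⋆_ : (ℕ → ℚ) → (ℕ → ℚ) → ℕ → ℚ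
(X ⋆ Y) n = sumTo n (λ j → X j * Y (n ∸ j))

⋆-congˡ : ∀ {X X'} Y → (∀ j → X j ≡ X' j) → ∀ n → (X ⋆ Y) n ≡ (X' ⋆ Y) n
⋆-congˡ Y eq n = sumTo-cong n (λ j → cong (_* Y (n ∸ j)) (eq j))

⋆-congʳ : ∀ X {Y Y'} → (∀ j → Y j ≡ Y' j) → ∀ n → (X ⋆ Y) n ≡ (X ⋆ Y') n
⋆-congʳ X eq n = sumTo-cong n (λ j → cong (X j *_) (eq (n ∸ j)))

⋆-+ˡ : ∀ X X' Y n → ((λ j → X j + X' j) ⋆ Y) n ≡ (X ⋆ Y) n + (X' ⋆ Y) n
⋆-+ˡ X X' Y n = trans (sumTo-cong n (λ j → *-distribʳ-+ (Y (n ∸ j)) (X j) (X' j))) (sumTo-+ n _ _)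

⋆-+ʳ : ∀ X Y Y' n → (X ⋆ (λ j → Y j + Y' j)) n ≡ (X ⋆ Y) n + (X ⋆ Y') n
⋆-+ʳ X Y Y' n = trans (sumTo-cong n (λ j → *-distribˡ-+ (X j) (Y (n ∸ j)) (Y' (n ∸ j)))) (sumTo-+ n _ _)

⋆-*ˡ : ∀ c X Y n → ((λ j → c * X j) ⋆ Y) n ≡ c * (X ⋆ Y) n
⋆-*ˡ c X Y n = trans (sumTo-cong n (λ j → *-assoc c (X j) (Y (n ∸ j))))
  (sym (sumTo-*ˡ n c (λ j → X j * Y (n ∸ j))))

⋆-zeroˡ : ∀ X Y → (∀ j → X j ≡ 0ℚ) → ∀ n → (X ⋆ Y) n ≡ 0ℚ
⋆-zeroˡ X Y eq n = sumTo-zero n (λ j → X j * Y (n ∸ j))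
  (λ j _ → trans (cong (_* Y (n ∸ j)) (eq j)) (*-zeroˡ (Y (n ∸ j))))

⋆-sumToˡ : ∀ k (G : ℕ → ℕ → ℚ) Y n → ((λ j → sumTo k (λ m → G m j)) ⋆ Y) n ≡ sumTo k (λ m → (G m ⋆ Y) n)
⋆-sumToˡ k G Y n = trans (sumTo-cong n (λ j → sumTo-*ʳ k (Y (n ∸ j)) (λ m → G m j)))
  (sumTo-comm n k (λ j m → G m j * Y (n ∸ j)))

⋆-last : ∀ X Y n → (X ⋆ Y) (suc n) ≡ sumTo n (λ j → X j * Y (suc n ∸ j)) + X (suc n) * Y 0
⋆-last X Y n = cong (λ t → sumTo n (λ j → X j * Y (suc n ∸ j)) + X (suc n) * Y t) (ℕP.n∸n≡0 n)

⋆-δʳ : ∀ X n → (X ⋆ delta0) n ≡ X n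
⋆-δʳ X zero    = *-identityʳ (X 0)
⋆-δʳ X (suc n) = begin
  (X ⋆ delta0) (suc n)                                       ≡⟨ ⋆-last X delta0 n ⟩
  sumTo n (λ j → X j * delta0 (suc n ∸ j)) + X (suc n) * 1ℚ  ≡⟨ cong (_+ X (suc n) * 1ℚ) (sumTo-zero n _ off-diagonal) ⟩
  0ℚ + X (suc n) * 1ℚ                                        ≡⟨ solve 1 (λ x → con 0ℚ :+ x :* con 1ℚ := x) refl (X (suc n)) ⟩
  X (suc n)                                                  ∎
  where
  open ≡-Reasoning
  off-diagonal : ∀ j → j ≤ n → X j * delta0 (suc n ∸ j) ≡ 0ℚ
  off-diagonal j j≤n = trans (cong (λ t → X j * delta0 t) (ℕP.+-∸-assoc 1 j≤n)) (*-zeroʳ (X j))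

⋆-vanishing-below : ∀ X Y n → (∀ j → j < n → X j ≡ 0ℚ) → (X ⋆ Y) n ≡ X n * Y 0
⋆-vanishing-below X Y zero    _   = refl
⋆-vanishing-below X Y (suc n) eq = begin
  (X ⋆ Y) (suc n)                                                  ≡⟨ ⋆-last X Y n ⟩
  sumTo n (λ j → X j * Y (suc n ∸ j)) + X (suc n) * Y 0            ≡⟨ cong (_+ X (suc n) * Y 0) (sumTo-zero n _ below) ⟩
  0ℚ + X (suc n) * Y 0                                             ≡⟨ +-identityˡ (X (suc n) * Y 0) ⟩
  X (suc n) * Y 0                                                  ∎
  where
  open ≡-Reasoning
  below : ∀ j → j ≤ n → X j * Y (suc n ∸ j) ≡ 0ℚ
  below j j≤n = trans (cong (_* Y (suc n ∸ j)) (eq j (s≤s j≤n))) (*-zeroˡ (Y (suc n ∸ j)))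

⋆-agree-top : ∀ X X' Y n → (∀ j → j < n → X j ≡ X' j) → (X ⋆ Y) n ≡ (X' ⋆ Y) n → X n * Y 0 ≡ X' n * Y 0
⋆-agree-top X X' Y zero    _  eq = eq
⋆-agree-top X X' Y (suc n) below eq = ∙-cancelˡ (sumTo n (λ j → X j * Y (suc n ∸ j))) _ _ (begin
  sumTo n (λ j → X j * Y (suc n ∸ j)) + X (suc n) * Y 0    ≡⟨ ⋆-last X Y n ⟨
  (X ⋆ Y) (suc n)                                          ≡⟨ eq ⟩
  (X' ⋆ Y) (suc n)                                         ≡⟨ ⋆-last X' Y n ⟩
  sumTo n (λ j → X' j * Y (suc n ∸ j)) + X' (suc n) * Y 0  ≡⟨ cong (_+ X' (suc n) * Y 0) (sym same-prefix) ⟩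
  sumTo n (λ j → X j * Y (suc n ∸ j)) + X' (suc n) * Y 0   ∎)
  where
  open ≡-Reasoning
  same-prefix : sumTo n (λ j → X j * Y (suc n ∸ j)) ≡ sumTo n (λ j → X' j * Y (suc n ∸ j))
  same-prefix = sumTo-cong≤ n (λ j j≤n → cong (_* Y (suc n ∸ j)) (below j (s≤s j≤n)))

⋆-cancelʳ-≤ : ∀ X X' Y → Y 0 ≡ 1ℚ → ∀ K → (∀ n → n ≤ K → (X ⋆ Y) n ≡ (X' ⋆ Y) n) → ∀ k → k ≤ K → X k ≡ X' k
⋆-cancelʳ-≤ X X' Y Y0≡1 K agree = <-rec (λ k → k ≤ K → X k ≡ X' k) step
  where
  step : ∀ k → (∀ {j} → j < k → j ≤ K → X j ≡ X' j) → k ≤ K → X k ≡ X' k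
  step k below k≤K = begin
    X k         ≡⟨ *-identityʳ (X k) ⟨
    X k * 1ℚ    ≡⟨ cong (X k *_) Y0≡1 ⟨
    X k * Y 0   ≡⟨ ⋆-agree-top X X' Y k (λ j j<k → below j<k (ℕP.<⇒≤ (ℕP.<-≤-trans j<k k≤K))) (agree k k≤K) ⟩
    X' k * Y 0  ≡⟨ cong (X' k *_) Y0≡1 ⟩
    X' k * 1ℚ   ≡⟨ *-identityʳ (X' k) ⟩
    X' k        ∎
    where open ≡-Reasoning

shift : (ℕ → ℚ) → ℕ → ℚ
shift X zero    = 0ℚ
shift X (suc n) = X n

onePlusX : (ℕ → ℚ) → ℕ → ℚ
onePlusX X n = X n + shift X n

⋆-shiftʳ : ∀ X Y n → (X ⋆ shift Y) n ≡ shift (X ⋆ Y) n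
⋆-shiftʳ X Y zero    = *-zeroʳ (X 0)
⋆-shiftʳ X Y (suc n) = begin
  (X ⋆ shift Y) (suc n)                                             ≡⟨ ⋆-last X (shift Y) n ⟩
  sumTo n (λ j → X j * shift Y (suc n ∸ j)) + X (suc n) * 0ℚ       ≡⟨ cong₂ _+_ (sumTo-cong≤ n unshift) (*-zeroʳ (X (suc n))) ⟩
  (X ⋆ Y) n + 0ℚ                                                    ≡⟨ +-identityʳ ((X ⋆ Y) n) ⟩
  (X ⋆ Y) n                                                         ∎
  where
  open ≡-Reasoning
  unshift : ∀ j → j ≤ n → X j * shift Y (suc n ∸ j) ≡ X j * Y (n ∸ j)
  unshift j j≤n = cong (λ t → X j * shift Y t) (ℕP.+-∸-assoc 1 j≤n)

⋆-shiftˡ : ∀ X Y n → (shift X ⋆ Y) n ≡ shift (X ⋆ Y) n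
⋆-shiftˡ X Y zero    = *-zeroˡ (Y 0)
⋆-shiftˡ X Y (suc n) = begin
  (shift X ⋆ Y) (suc n)                      ≡⟨ sumTo-unshift n (λ j → shift X j * Y (suc n ∸ j)) ⟩
  0ℚ * Y (suc n) + (X ⋆ Y) n                 ≡⟨ cong (_+ (X ⋆ Y) n) (*-zeroˡ (Y (suc n))) ⟩
  0ℚ + (X ⋆ Y) n                             ≡⟨ +-identityˡ ((X ⋆ Y) n) ⟩
  (X ⋆ Y) n                                  ∎
  where open ≡-Reasoning

⋆-onePlusXʳ : ∀ X Y n → (X ⋆ onePlusX Y) n ≡ onePlusX (X ⋆ Y) n
⋆-onePlusXʳ X Y n = trans (⋆-+ʳ X Y (shift Y) n) (cong ((X ⋆ Y) n +_) (⋆-shiftʳ X Y n))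

⋆-onePlusXˡ : ∀ X Y n → (onePlusX X ⋆ Y) n ≡ onePlusX (X ⋆ Y) n
⋆-onePlusXˡ X Y n = trans (⋆-+ˡ X (shift X) Y n) (cong ((X ⋆ Y) n +_) (⋆-shiftˡ X Y n))

onePlusX-cong : ∀ {X Y} → (∀ j → X j ≡ Y j) → ∀ n → onePlusX X n ≡ onePlusX Y n
onePlusX-cong eq zero    = cong (_+ 0ℚ) (eq 0)
onePlusX-cong eq (suc n) = cong₂ _+_ (eq (suc n)) (eq n)

onePlusX-+ : ∀ X Y n → onePlusX (λ j → X j + Y j) n ≡ onePlusX X n + onePlusX Y n
onePlusX-+ X Y zero    = solve 2 (λ x y → (x :+ y) :+ con 0ℚ := (x :+ con 0ℚ) :+ (y :+ con 0ℚ)) refl (X 0) (Y 0)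
onePlusX-+ X Y (suc n) = solve 4 (λ x y x' y' → (x :+ y) :+ (x' :+ y') := (x :+ x') :+ (y :+ y')) refl
  (X (suc n)) (Y (suc n)) (X n) (Y n)

onePlusX-injective : ∀ X Y → (∀ n → onePlusX X n ≡ onePlusX Y n) → ∀ n → X n ≡ Y n
onePlusX-injective X Y eq zero    = ∙-cancelʳ 0ℚ (X 0) (Y 0) (eq 0)
onePlusX-injective X Y eq (suc n) = ∙-cancelʳ (X n) (X (suc n)) (Y (suc n))
  (trans (eq (suc n)) (cong (Y (suc n) +_) (sym (onePlusX-injective X Y eq n))))

-- The operator x d/dx + c.
euler : ℕ → (ℕ → ℚ) → ℕ → ℚ
euler c X n = ℕ→ℚ (n ℕ.+ c) * X n

euler-⋆ : ∀ c d X Y n → euler (c ℕ.+ d) (X ⋆ Y) n ≡ (euler c X ⋆ Y) n + (X ⋆ euler d Y) n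
euler-⋆ c d X Y n = begin
  ℕ→ℚ (n ℕ.+ (c ℕ.+ d)) * (X ⋆ Y) n
    ≡⟨ sumTo-*ˡ n (ℕ→ℚ (n ℕ.+ (c ℕ.+ d))) (λ j → X j * Y (n ∸ j)) ⟩
  sumTo n (λ j → ℕ→ℚ (n ℕ.+ (c ℕ.+ d)) * (X j * Y (n ∸ j)))
    ≡⟨ sumTo-cong≤ n split ⟩
  sumTo n (λ j → euler c X j * Y (n ∸ j) + X j * euler d Y (n ∸ j))
    ≡⟨ sumTo-+ n _ _ ⟩
  (euler c X ⋆ Y) n + (X ⋆ euler d Y) n ∎
  where
  open ≡-Reasoning
  weights : ∀ j → j ≤ n → n ℕ.+ (c ℕ.+ d) ≡ (j ℕ.+ c) ℕ.+ ((n ∸ j) ℕ.+ d)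
  weights j j≤n = trans (cong (ℕ._+ (c ℕ.+ d)) (sym (ℕP.m+[n∸m]≡n j≤n))) (+-interchange j (n ∸ j) c d)
  split : ∀ j → j ≤ n →
    ℕ→ℚ (n ℕ.+ (c ℕ.+ d)) * (X j * Y (n ∸ j)) ≡ euler c X j * Y (n ∸ j) + X j * euler d Y (n ∸ j)
  split j j≤n = begin
    ℕ→ℚ (n ℕ.+ (c ℕ.+ d)) * (X j * Y (n ∸ j))
      ≡⟨ cong (λ t → ℕ→ℚ t * (X j * Y (n ∸ j))) (weights j j≤n) ⟩
    ℕ→ℚ ((j ℕ.+ c) ℕ.+ ((n ∸ j) ℕ.+ d)) * (X j * Y (n ∸ j))
      ≡⟨ cong (_* (X j * Y (n ∸ j))) (ℕ→ℚ-homo-+ (j ℕ.+ c) ((n ∸ j) ℕ.+ d)) ⟩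
    (ℕ→ℚ (j ℕ.+ c) + ℕ→ℚ ((n ∸ j) ℕ.+ d)) * (X j * Y (n ∸ j))
      ≡⟨ solve 4 (λ a b x y → (a :+ b) :* (x :* y) := a :* x :* y :+ x :* (b :* y)) refl
           (ℕ→ℚ (j ℕ.+ c)) (ℕ→ℚ ((n ∸ j) ℕ.+ d)) (X j) (Y (n ∸ j)) ⟩
    euler c X j * Y (n ∸ j) + X j * euler d Y (n ∸ j) ∎

euler-injective : ∀ c {X Y} n → euler (suc c) X n ≡ euler (suc c) Y n → X n ≡ Y n
euler-injective c {X} {Y} n eq =
  ℕ→ℚ-*-cancelˡ (suc (n ℕ.+ c)) (subst (λ t → ℕ→ℚ t * X n ≡ ℕ→ℚ t * Y n) (ℕP.+-suc n c) eq)

-- Powers of ln(1+x)/x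

euler-logCoeff : ∀ n → euler 1 logCoeff n ≡ neg1^ n
euler-logCoeff n = begin
  ℕ→ℚ (n ℕ.+ 1) * (neg1^ n * recip (suc n))  ≡⟨ cong (λ t → ℕ→ℚ t * (neg1^ n * recip (suc n))) (ℕP.+-comm n 1) ⟩
  ℕ→ℚ (suc n) * (neg1^ n * recip (suc n))    ≡⟨ solve 3 (λ c s r → c :* (s :* r) := s :* (c :* r)) refl
                                                   (ℕ→ℚ (suc n)) (neg1^ n) (recip (suc n)) ⟩
  neg1^ n * (ℕ→ℚ (suc n) * recip (suc n))    ≡⟨ cong (neg1^ n *_) (ℕ→ℚ-*-recip (suc n)) ⟩
  neg1^ n * 1ℚ                               ≡⟨ *-identityʳ (neg1^ n) ⟩
  neg1^ n                                    ∎
  where open ≡-Reasoning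

onePlusX-neg1^ : ∀ n → onePlusX neg1^ n ≡ delta0 n
onePlusX-neg1^ zero    = +-identityʳ 1ℚ
onePlusX-neg1^ (suc n) = +-inverseˡ (neg1^ n)

-- x · logCoeff is ln(1+x), so euler 1 logCoeff is its derivative 1/(1+x).
onePlusX-euler-logCoeff : ∀ n → onePlusX (euler 1 logCoeff) n ≡ delta0 n
onePlusX-euler-logCoeff n = trans (onePlusX-cong euler-logCoeff n) (onePlusX-neg1^ n)

stirling1-vanishing : ∀ {n k} → n < k → stirling1 n k ≡ ℤ.+ 0
stirling1-vanishing {zero}  {suc k} _ = refl
stirling1-vanishing {suc n} {suc k} (s≤s n<k)
  rewrite stirling1-vanishing n<k | stirling1-vanishing (ℕP.m<n⇒m<1+n n<k) | ℤP.*-zeroʳ (ℤ.+ n) = refl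

-- The coefficient of x^N in ln(1+x)^m / m!.
stirling1/fact : ℕ → ℕ → ℚ
stirling1/fact N m = ℤ→ℚ (stirling1 N m) * recip (N !)

stirling1/fact-vanishing : ∀ {N m} → N < m → stirling1/fact N m ≡ 0ℚ
stirling1/fact-vanishing {N} N<m =
  trans (cong (λ s → ℤ→ℚ s * recip (N !)) (stirling1-vanishing N<m)) (*-zeroˡ (recip (N !)))

-- The Stirling recursion divided by N!: the derivative of ln(1+x)^(m+1)/(m+1)!, times 1 + x, is ln(1+x)^m/m!.
stirling1/fact-suc : ∀ N m →
  ℕ→ℚ (suc N) * stirling1/fact (suc N) (suc m) + ℕ→ℚ N * stirling1/fact N (suc m) ≡ stirling1/fact N m
stirling1/fact-suc N m = begin
  c₁ * (ℤ→ℚ (s₀ ℤ.- (ℤ.+ N) ℤ.* s₁) * recip (suc N ℕ.* N !)) + c * (S₁ * r)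
    ≡⟨ cong (λ t → c₁ * (t * recip (suc N ℕ.* N !)) + c * (S₁ * r)) recursion ⟩
  c₁ * ((S₀ - c * S₁) * recip (suc N ℕ.* N !)) + c * (S₁ * r)
    ≡⟨ solve 6 (λ c₁ S₀ c S₁ r₁ r → c₁ :* ((S₀ :- c :* S₁) :* r₁) :+ c :* (S₁ :* r)
                                   := (c₁ :* r₁) :* (S₀ :- c :* S₁) :+ c :* (S₁ :* r)) refl
         c₁ S₀ c S₁ (recip (suc N ℕ.* N !)) r ⟩
  (c₁ * recip (suc N ℕ.* N !)) * (S₀ - c * S₁) + c * (S₁ * r)
    ≡⟨ cong (λ t → t * (S₀ - c * S₁) + c * (S₁ * r)) (ℕ→ℚ-*-recip-cancelˡ (suc N) (N !)) ⟩
  r * (S₀ - c * S₁) + c * (S₁ * r)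
    ≡⟨ solve 4 (λ r S₀ c S₁ → r :* (S₀ :- c :* S₁) :+ c :* (S₁ :* r) := S₀ :* r) refl r S₀ c S₁ ⟩
  S₀ * r ∎
  where
  open ≡-Reasoning
  c₁ = ℕ→ℚ (suc N)
  c = ℕ→ℚ N
  r = recip (N !)
  s₀ = stirling1 N m
  s₁ = stirling1 N (suc m)
  S₀ = ℤ→ℚ s₀
  S₁ = ℤ→ℚ s₁
  recursion : ℤ→ℚ (s₀ ℤ.- (ℤ.+ N) ℤ.* s₁) ≡ S₀ - c * S₁
  recursion = trans (ℤ→ℚ-homo-- s₀ ((ℤ.+ N) ℤ.* s₁)) (cong (λ t → S₀ - t) (ℤ→ℚ-homo-* (ℤ.+ N) s₁))

-- The coefficient of x^n in (ln(1+x)/x)^m.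
stirlingForm : ℕ → ℕ → ℚ
stirlingForm m n = ℕ→ℚ (m !) * stirling1/fact (n ℕ.+ m) m

stirlingForm-zero : ∀ n → stirlingForm 0 n ≡ delta0 n
stirlingForm-zero zero    = refl
stirlingForm-zero (suc n) = trans (*-identityˡ _) (*-zeroˡ (recip (suc (n ℕ.+ 0) !)))

euler-stirlingForm-zero : ∀ n → euler 0 (stirlingForm 0) n ≡ 0ℚ
euler-stirlingForm-zero zero    = *-zeroˡ (stirlingForm 0 0)
euler-stirlingForm-zero (suc n) =
  trans (cong (ℕ→ℚ (suc n ℕ.+ 0) *_) (stirlingForm-zero (suc n))) (*-zeroʳ (ℕ→ℚ (suc n ℕ.+ 0)))

euler-stirlingForm-suc : ∀ m j → euler (suc m) (stirlingForm (suc m)) j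
  ≡ ℕ→ℚ (suc m !) * (ℕ→ℚ (suc (j ℕ.+ m)) * stirling1/fact (suc (j ℕ.+ m)) (suc m))
euler-stirlingForm-suc m j = begin
  ℕ→ℚ (j ℕ.+ suc m) * (f * stirling1/fact (j ℕ.+ suc m) (suc m))
    ≡⟨ cong (λ t → ℕ→ℚ t * (f * stirling1/fact t (suc m))) (ℕP.+-suc j m) ⟩
  ℕ→ℚ (suc (j ℕ.+ m)) * (f * stirling1/fact (suc (j ℕ.+ m)) (suc m))
    ≡⟨ solve 3 (λ x y z → x :* (y :* z) := y :* (x :* z)) refl
         (ℕ→ℚ (suc (j ℕ.+ m))) f (stirling1/fact (suc (j ℕ.+ m)) (suc m)) ⟩
  f * (ℕ→ℚ (suc (j ℕ.+ m)) * stirling1/fact (suc (j ℕ.+ m)) (suc m)) ∎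
  where
  open ≡-Reasoning
  f = ℕ→ℚ (suc m !)

shift-euler-stirlingForm-suc : ∀ m j → shift (euler (suc m) (stirlingForm (suc m))) j
  ≡ ℕ→ℚ (suc m !) * (ℕ→ℚ (j ℕ.+ m) * stirling1/fact (j ℕ.+ m) (suc m))
shift-euler-stirlingForm-suc m zero = sym (begin
  f * (ℕ→ℚ m * stirling1/fact m (suc m))  ≡⟨ cong (λ t → f * (ℕ→ℚ m * t)) (stirling1/fact-vanishing (ℕP.n<1+n m)) ⟩
  f * (ℕ→ℚ m * 0ℚ)                        ≡⟨ cong (f *_) (*-zeroʳ (ℕ→ℚ m)) ⟩
  f * 0ℚ                                  ≡⟨ *-zeroʳ f ⟩
  0ℚ                                      ∎)
  where
  open ≡-Reasoning
  f = ℕ→ℚ (suc m !)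
shift-euler-stirlingForm-suc m (suc j) = euler-stirlingForm-suc m j

onePlusX-euler-stirlingForm : ∀ m j →
  onePlusX (euler (suc m) (stirlingForm (suc m))) j ≡ ℕ→ℚ (suc m) * stirlingForm m j
onePlusX-euler-stirlingForm m j = begin
  onePlusX (euler (suc m) (stirlingForm (suc m))) j
    ≡⟨ cong₂ _+_ (euler-stirlingForm-suc m j) (shift-euler-stirlingForm-suc m j) ⟩
  f * (ℕ→ℚ (suc N) * stirling1/fact (suc N) (suc m)) + f * (ℕ→ℚ N * stirling1/fact N (suc m))
    ≡⟨ *-distribˡ-+ f _ _ ⟨
  f * (ℕ→ℚ (suc N) * stirling1/fact (suc N) (suc m) + ℕ→ℚ N * stirling1/fact N (suc m))
    ≡⟨ cong (f *_) (stirling1/fact-suc N m) ⟩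
  f * stirling1/fact N m
    ≡⟨ cong (_* stirling1/fact N m) (ℕ→ℚ-homo-* (suc m) (m !)) ⟩
  ℕ→ℚ (suc m) * ℕ→ℚ (m !) * stirling1/fact N m
    ≡⟨ *-assoc (ℕ→ℚ (suc m)) (ℕ→ℚ (m !)) (stirling1/fact N m) ⟩
  ℕ→ℚ (suc m) * stirlingForm m j ∎
  where
  open ≡-Reasoning
  f = ℕ→ℚ (suc m !)
  N = j ℕ.+ m

-- Both sides have the same image (m + 1) · stirlingForm m under (1 + x)(x d/dx + m + 1);
-- the hypothesis is what induction on m supplies.
stirlingForm-⋆-logCoeff-of : ∀ m →
  (∀ n → (euler m (stirlingForm m) ⋆ onePlusX logCoeff) n ≡ ℕ→ℚ m * stirlingForm m n) →
  ∀ n → (stirlingForm m ⋆ logCoeff) n ≡ stirlingForm (suc m) n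
stirlingForm-⋆-logCoeff-of m hyp n =
  euler-injective m {S ⋆ logCoeff} {stirlingForm (suc m)} n
    (onePlusX-injective (euler (suc m) (S ⋆ logCoeff)) (euler (suc m) (stirlingForm (suc m))) same-image n)
  where
  open ≡-Reasoning
  S = stirlingForm m
  leibniz : ∀ j → euler (suc m) (S ⋆ logCoeff) j ≡ (euler m S ⋆ logCoeff) j + (S ⋆ euler 1 logCoeff) j
  leibniz j = trans (cong (λ c → euler c (S ⋆ logCoeff) j) (ℕP.+-comm 1 m)) (euler-⋆ m 1 S logCoeff j)
  same-image : ∀ k → onePlusX (euler (suc m) (S ⋆ logCoeff)) k ≡ onePlusX (euler (suc m) (stirlingForm (suc m))) k
  same-image k = begin
    onePlusX (euler (suc m) (S ⋆ logCoeff)) k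
      ≡⟨ onePlusX-cong leibniz k ⟩
    onePlusX (λ j → (euler m S ⋆ logCoeff) j + (S ⋆ euler 1 logCoeff) j) k
      ≡⟨ onePlusX-+ (euler m S ⋆ logCoeff) (S ⋆ euler 1 logCoeff) k ⟩
    onePlusX (euler m S ⋆ logCoeff) k + onePlusX (S ⋆ euler 1 logCoeff) k
      ≡⟨ cong₂ _+_ (⋆-onePlusXʳ (euler m S) logCoeff k) (⋆-onePlusXʳ S (euler 1 logCoeff) k) ⟨
    (euler m S ⋆ onePlusX logCoeff) k + (S ⋆ onePlusX (euler 1 logCoeff)) k
      ≡⟨ cong₂ _+_ (hyp k) (trans (⋆-congʳ S onePlusX-euler-logCoeff k) (⋆-δʳ S k)) ⟩
    ℕ→ℚ m * S k + S k
      ≡⟨ solve 2 (λ c s → c :* s :+ s := (con 1ℚ :+ c) :* s) refl (ℕ→ℚ m) (S k) ⟩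
    (1ℚ + ℕ→ℚ m) * S k
      ≡⟨ cong (_* S k) (ℕ→ℚ-homo-+ 1 m) ⟨
    ℕ→ℚ (suc m) * S k
      ≡⟨ onePlusX-euler-stirlingForm m k ⟨
    onePlusX (euler (suc m) (stirlingForm (suc m))) k ∎

euler-stirlingForm-zero-⋆ : ∀ n → (euler 0 (stirlingForm 0) ⋆ onePlusX logCoeff) n ≡ ℕ→ℚ 0 * stirlingForm 0 n
euler-stirlingForm-zero-⋆ n =
  trans (⋆-zeroˡ _ (onePlusX logCoeff) euler-stirlingForm-zero n) (sym (*-zeroˡ (stirlingForm 0 n)))

euler-stirlingForm-suc-⋆ : ∀ m → (∀ n → (stirlingForm m ⋆ logCoeff) n ≡ stirlingForm (suc m) n) →
  ∀ n → (euler (suc m) (stirlingForm (suc m)) ⋆ onePlusX logCoeff) n ≡ ℕ→ℚ (suc m) * stirlingForm (suc m) n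
euler-stirlingForm-suc-⋆ m hyp n = begin
  (E ⋆ onePlusX logCoeff) n                                  ≡⟨ ⋆-onePlusXʳ E logCoeff n ⟩
  onePlusX (E ⋆ logCoeff) n                                  ≡⟨ ⋆-onePlusXˡ E logCoeff n ⟨
  (onePlusX E ⋆ logCoeff) n                                  ≡⟨ ⋆-congˡ logCoeff (onePlusX-euler-stirlingForm m) n ⟩
  ((λ j → ℕ→ℚ (suc m) * stirlingForm m j) ⋆ logCoeff) n     ≡⟨ ⋆-*ˡ (ℕ→ℚ (suc m)) (stirlingForm m) logCoeff n ⟩
  ℕ→ℚ (suc m) * (stirlingForm m ⋆ logCoeff) n               ≡⟨ cong (ℕ→ℚ (suc m) *_) (hyp n) ⟩
  ℕ→ℚ (suc m) * stirlingForm (suc m) n                      ∎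
  where
  open ≡-Reasoning
  E = euler (suc m) (stirlingForm (suc m))

stirlingForm-⋆-logCoeff : ∀ m n → (stirlingForm m ⋆ logCoeff) n ≡ stirlingForm (suc m) n
stirlingForm-⋆-logCoeff zero    = stirlingForm-⋆-logCoeff-of zero euler-stirlingForm-zero-⋆
stirlingForm-⋆-logCoeff (suc m) =
  stirlingForm-⋆-logCoeff-of (suc m) (euler-stirlingForm-suc-⋆ m (stirlingForm-⋆-logCoeff m))

m!*[[n+m]Cm*n!]≡[n+m]! : ∀ n m → m ! ℕ.* (((n ℕ.+ m) C m) ℕ.* n !) ≡ (n ℕ.+ m) !
m!*[[n+m]Cm*n!]≡[n+m]! n m = begin
  m ! ℕ.* (c ℕ.* n !)                        ≡⟨ ℕP.*-assoc (m !) c (n !) ⟨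
  m ! ℕ.* c ℕ.* n !                          ≡⟨ cong (ℕ._* n !) (ℕP.*-comm (m !) c) ⟩
  c ℕ.* m ! ℕ.* n !                          ≡⟨ ℕP.*-assoc c (m !) (n !) ⟩
  c ℕ.* (m ! ℕ.* n !)                        ≡⟨ cong (λ t → c ℕ.* (m ! ℕ.* t !)) (ℕP.m+n∸n≡m n m) ⟨
  c ℕ.* (m ! ℕ.* (n ℕ.+ m ∸ m) !)            ≡⟨ cong (ℕ._* (m ! ℕ.* (n ℕ.+ m ∸ m) !)) (nCk≡n!/k![n-k]! m≤n+m) ⟩
  (n ℕ.+ m) ! ℕ./ (m ! ℕ.* (n ℕ.+ m ∸ m) !) ℕ.* (m ! ℕ.* (n ℕ.+ m ∸ m) !)
                                             ≡⟨ m/n*n≡m (k![n∸k]!∣n! m≤n+m) ⟩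
  (n ℕ.+ m) !                                ∎
  where
  open ≡-Reasoning
  c = (n ℕ.+ m) C m
  m≤n+m = ℕP.m≤n+m m n
  instance _ = ℕP._!*_!≢0 m (n ℕ.+ m ∸ m)

stirlingForm≡term : ∀ m n → stirlingForm m n ≡ recip (n !) * term n m
stirlingForm≡term m n = begin
  ℕ→ℚ (m !) * (s * recip ((n ℕ.+ m) !))
    ≡⟨ cong (λ t → ℕ→ℚ (m !) * (s * recip t)) (m!*[[n+m]Cm*n!]≡[n+m]! n m) ⟨
  ℕ→ℚ (m !) * (s * recip (m ! ℕ.* (c ℕ.* n !)))
    ≡⟨ solve 3 (λ f s r → f :* (s :* r) := s :* (f :* r)) refl (ℕ→ℚ (m !)) s (recip (m ! ℕ.* (c ℕ.* n !))) ⟩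
  s * (ℕ→ℚ (m !) * recip (m ! ℕ.* (c ℕ.* n !)))
    ≡⟨ cong (s *_) (ℕ→ℚ-*-recip-cancelˡ (m !) (c ℕ.* n !) {{ℕP._!≢0 m}}) ⟩
  s * recip (c ℕ.* n !)
    ≡⟨ cong (s *_) (recip-homo-* c (n !)) ⟩
  s * (recip c * recip (n !))
    ≡⟨ solve 3 (λ s r q → s :* (r :* q) := q :* (s :* r)) refl s (recip c) (recip (n !)) ⟩
  recip (n !) * term n m ∎
  where
  open ≡-Reasoning
  c = (n ℕ.+ m) C m
  s = ℤ→ℚ (stirling1 (n ℕ.+ m) m)

altBinomialSum : ℕ → (ℕ → ℚ) → ℚ
altBinomialSum k p = sumTo k (λ m → neg1^ m * ℕ→ℚ (k C m) * p m)

altBinomial-pascal : ∀ k m q →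
  neg1^ m * ℕ→ℚ (k C m) * q + neg1^ m * ℕ→ℚ (k C suc m) * q ≡ neg1^ m * ℕ→ℚ (suc k C suc m) * q
altBinomial-pascal k m q = begin
  neg1^ m * ℕ→ℚ (k C m) * q + neg1^ m * ℕ→ℚ (k C suc m) * q
    ≡⟨ solve 4 (λ s a b q → s :* a :* q :+ s :* b :* q := s :* (a :+ b) :* q) refl
         (neg1^ m) (ℕ→ℚ (k C m)) (ℕ→ℚ (k C suc m)) q ⟩
  neg1^ m * (ℕ→ℚ (k C m) + ℕ→ℚ (k C suc m)) * q
    ≡⟨ cong (λ t → neg1^ m * t * q) (ℕ→ℚ-homo-+ (k C m) (k C suc m)) ⟨
  neg1^ m * ℕ→ℚ (k C m ℕ.+ k C suc m) * q
    ≡⟨ cong (λ t → neg1^ m * ℕ→ℚ t * q) (nCk+nC[k+1]≡[n+1]C[k+1] k m) ⟩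
  neg1^ m * ℕ→ℚ (suc k C suc m) * q ∎
  where open ≡-Reasoning

binomial-vanishing : ∀ {k m} s q → k < m → s * ℕ→ℚ (k C m) * q ≡ 0ℚ
binomial-vanishing {k} {m} s q k<m = begin
  s * ℕ→ℚ (k C m) * q  ≡⟨ cong (λ t → s * ℕ→ℚ t * q) (k>n⇒nCk≡0 k<m) ⟩
  s * 0ℚ * q           ≡⟨ cong (_* q) (*-zeroʳ s) ⟩
  0ℚ * q               ≡⟨ *-zeroˡ q ⟩
  0ℚ                   ∎
  where open ≡-Reasoning

altBinomialSum-*ˡ : ∀ k c p → altBinomialSum k (λ m → c * p m) ≡ c * altBinomialSum k p
altBinomialSum-*ˡ k c p = trans
  (sumTo-cong k (λ m → solve 3 (λ a c x → a :* (c :* x) := c :* (a :* x)) refl (neg1^ m * ℕ→ℚ (k C m)) c (p m)))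
  (sym (sumTo-*ˡ k c (λ m → neg1^ m * ℕ→ℚ (k C m) * p m)))

altBinomialSum-suc : ∀ k p → altBinomialSum (suc k) p ≡ altBinomialSum k p - altBinomialSum k (λ m → p (suc m))
altBinomialSum-suc k p = begin
  altBinomialSum (suc k) p
    ≡⟨ sumTo-unshift k (summand (suc k)) ⟩
  p₀ + sumTo k (λ m → summand (suc k) (suc m))
    ≡⟨ cong (p₀ +_) (trans (sumTo-cong k pascal) (sumTo-- k (λ m → summand k (suc m)) _)) ⟩
  p₀ + (sumTo k (λ m → summand k (suc m)) - altBinomialSum k (λ m → p (suc m)))
    ≡⟨ solve 3 (λ a b c → a :+ (b :- c) := (a :+ b) :- c) refl p₀ (sumTo k (λ m → summand k (suc m))) _ ⟩
  (p₀ + sumTo k (λ m → summand k (suc m))) - altBinomialSum k (λ m → p (suc m))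
    ≡⟨ cong (_- altBinomialSum k (λ m → p (suc m))) (trans (sym (sumTo-last-zero k (summand k) top)) (sumTo-unshift k (summand k))) ⟨
  altBinomialSum k p - altBinomialSum k (λ m → p (suc m)) ∎
  where
  open ≡-Reasoning
  summand : ℕ → ℕ → ℚ
  summand k m = neg1^ m * ℕ→ℚ (k C m) * p m
  p₀ = summand k 0
  top : summand k (suc k) ≡ 0ℚ
  top = binomial-vanishing (neg1^ (suc k)) (p (suc k)) (ℕP.n<1+n k)
  pascal : ∀ m → summand (suc k) (suc m) ≡ summand k (suc m) - neg1^ m * ℕ→ℚ (k C m) * p (suc m)
  pascal m = begin
    - s * ℕ→ℚ (suc k C suc m) * q                 ≡⟨ solve 3 (λ s c q → :- s :* c :* q := :- (s :* c :* q)) refl s _ q ⟩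
    - (s * ℕ→ℚ (suc k C suc m) * q)               ≡⟨ cong -_ (altBinomial-pascal k m q) ⟨
    - (s * ℕ→ℚ (k C m) * q + s * ℕ→ℚ (k C suc m) * q)
      ≡⟨ solve 4 (λ s a b q → :- (s :* a :* q :+ s :* b :* q) := :- s :* b :* q :- s :* a :* q) refl
           s (ℕ→ℚ (k C m)) (ℕ→ℚ (k C suc m)) q ⟩
    - s * ℕ→ℚ (k C suc m) * q - s * ℕ→ℚ (k C m) * q ∎
    where
    s = neg1^ m
    q = p (suc m)

sumTo-altBinomialSum : ∀ n p →
  sumTo n (λ k → altBinomialSum k p) ≡ sumTo n (λ m → neg1^ m * ℕ→ℚ (suc n C suc m) * p m)
sumTo-altBinomialSum zero    p = refl
sumTo-altBinomialSum (suc n) p = begin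
  sumTo n (λ k → altBinomialSum k p) + altBinomialSum (suc n) p
    ≡⟨ cong (_+ altBinomialSum (suc n) p) (sumTo-altBinomialSum n p) ⟩
  sumTo n (g n) + altBinomialSum (suc n) p
    ≡⟨ cong (_+ altBinomialSum (suc n) p) (sumTo-last-zero n (g n) (binomial-vanishing (neg1^ (suc n)) (p (suc n)) (ℕP.n<1+n (suc n)))) ⟨
  sumTo (suc n) (g n) + altBinomialSum (suc n) p
    ≡⟨ sumTo-+ (suc n) (g n) (λ m → neg1^ m * ℕ→ℚ (suc n C m) * p m) ⟨
  sumTo (suc n) (λ m → g n m + neg1^ m * ℕ→ℚ (suc n C m) * p m)
    ≡⟨ sumTo-cong (suc n) (λ m → trans (+-comm (g n m) _) (altBinomial-pascal (suc n) m (p m))) ⟩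
  sumTo (suc n) (g (suc n)) ∎
  where
  open ≡-Reasoning
  g : ℕ → ℕ → ℚ
  g n m = neg1^ m * ℕ→ℚ (suc n C suc m) * p m

altBinomialSum-cong : ∀ k {p q} → (∀ m → p m ≡ q m) → altBinomialSum k p ≡ altBinomialSum k q
altBinomialSum-cong k eq = sumTo-cong k (λ m → cong (neg1^ m * ℕ→ℚ (k C m) *_) (eq m))

-- Inverting ln(1+x)/x

-- (1 - ln(1+x)/x)^k: the terms of the geometric series for x / ln(1+x).
oneMinusLog^ : ℕ → ℕ → ℚ
oneMinusLog^ zero      = delta0
oneMinusLog^ (suc k) n = oneMinusLog^ k n - (oneMinusLog^ k ⋆ logCoeff) n

oneMinusLog^-vanishing : ∀ k n → n < k → oneMinusLog^ k n ≡ 0ℚ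
oneMinusLog^-vanishing (suc k) n (s≤s n≤k) = begin
  oneMinusLog^ k n - (oneMinusLog^ k ⋆ logCoeff) n
    ≡⟨ cong (λ t → oneMinusLog^ k n - t) (⋆-vanishing-below (oneMinusLog^ k) logCoeff n below) ⟩
  oneMinusLog^ k n - oneMinusLog^ k n * 1ℚ
    ≡⟨ solve 1 (λ q → q :- q :* con 1ℚ := con 0ℚ) refl (oneMinusLog^ k n) ⟩
  0ℚ ∎
  where
  open ≡-Reasoning
  below : ∀ j → j < n → oneMinusLog^ k j ≡ 0ℚ
  below j j<n = oneMinusLog^-vanishing k j (ℕP.<-≤-trans j<n n≤k)

oneMinusLog^≡altBinomialSum : ∀ k n → oneMinusLog^ k n ≡ altBinomialSum k (λ m → stirlingForm m n)
oneMinusLog^≡altBinomialSum zero    n = sym (trans (*-identityˡ (stirlingForm 0 n)) (stirlingForm-zero n))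
oneMinusLog^≡altBinomialSum (suc k) n = begin
  oneMinusLog^ k n - (oneMinusLog^ k ⋆ logCoeff) n
    ≡⟨ cong₂ _-_ (oneMinusLog^≡altBinomialSum k n) (⋆-congˡ logCoeff (oneMinusLog^≡altBinomialSum k) n) ⟩
  altBinomialSum k (λ m → stirlingForm m n) - ((λ j → sumTo k (λ m → c m * stirlingForm m j)) ⋆ logCoeff) n
    ≡⟨ cong (λ t → altBinomialSum k (λ m → stirlingForm m n) - t)
         (trans (⋆-sumToˡ k (λ m j → c m * stirlingForm m j) logCoeff n) (sumTo-cong k raise)) ⟩
  altBinomialSum k (λ m → stirlingForm m n) - altBinomialSum k (λ m → stirlingForm (suc m) n)
    ≡⟨ altBinomialSum-suc k (λ m → stirlingForm m n) ⟨
  altBinomialSum (suc k) (λ m → stirlingForm m n) ∎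
  where
  open ≡-Reasoning
  c : ℕ → ℚ
  c m = neg1^ m * ℕ→ℚ (k C m)
  raise : ∀ m → ((λ j → c m * stirlingForm m j) ⋆ logCoeff) n ≡ c m * stirlingForm (suc m) n
  raise m = trans (⋆-*ˡ (c m) (stirlingForm m) logCoeff n) (cong (c m *_) (stirlingForm-⋆-logCoeff m n))

sum-oneMinusLog^-⋆-logCoeff : ∀ K n →
  ((λ j → sumTo K (λ k → oneMinusLog^ k j)) ⋆ logCoeff) n ≡ delta0 n - oneMinusLog^ (suc K) n
sum-oneMinusLog^-⋆-logCoeff K n = begin
  ((λ j → sumTo K (λ k → oneMinusLog^ k j)) ⋆ logCoeff) n   ≡⟨ ⋆-sumToˡ K oneMinusLog^ logCoeff n ⟩
  sumTo K (λ k → (oneMinusLog^ k ⋆ logCoeff) n)             ≡⟨ sumTo-cong K step ⟩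
  sumTo K (λ k → oneMinusLog^ k n - oneMinusLog^ (suc k) n) ≡⟨ sumTo-telescope K (λ k → oneMinusLog^ k n) ⟩
  delta0 n - oneMinusLog^ (suc K) n                         ∎
  where
  open ≡-Reasoning
  step : ∀ k → (oneMinusLog^ k ⋆ logCoeff) n ≡ oneMinusLog^ k n - oneMinusLog^ (suc k) n
  step k = solve 2 (λ q l → l := q :- (q :- l)) refl (oneMinusLog^ k n) ((oneMinusLog^ k ⋆ logCoeff) n)

bernoulli2≡sum-oneMinusLog^ : ∀ b → IsBernoulli2 b → ∀ n → b n ≡ sumTo n (λ k → oneMinusLog^ k n)
bernoulli2≡sum-oneMinusLog^ b isB n = sym (⋆-cancelʳ-≤ partial b logCoeff refl n agree n ℕP.≤-refl)
  where
  partial : ℕ → ℚ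
  partial j = sumTo n (λ k → oneMinusLog^ k j)
  agree : ∀ m → m ≤ n → (partial ⋆ logCoeff) m ≡ (b ⋆ logCoeff) m
  agree m m≤n = begin
    (partial ⋆ logCoeff) m               ≡⟨ sum-oneMinusLog^-⋆-logCoeff n m ⟩
    delta0 m - oneMinusLog^ (suc n) m    ≡⟨ cong (λ t → delta0 m - t) (oneMinusLog^-vanishing (suc n) m (s≤s m≤n)) ⟩
    delta0 m - 0ℚ                        ≡⟨ solve 1 (λ d → d :- con 0ℚ := d) refl (delta0 m) ⟩
    delta0 m                             ≡⟨ isB m ⟨
    (b ⋆ logCoeff) m                     ∎
    where open ≡-Reasoning

mainTheorem18 : (b : ℕ → ℚ) → IsBernoulli2 b →
    (n : ℕ) → (b n ≡ firstFormula n) × (firstFormula n ≡ secondFormula n)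
mainTheorem18 b isB n = bernoulli2≡firstFormula , cong (recip (n !) *_) (sumTo-altBinomialSum n (term n))
  where
  open ≡-Reasoning
  bernoulli2≡firstFormula : b n ≡ firstFormula n
  bernoulli2≡firstFormula = begin
    b n
      ≡⟨ bernoulli2≡sum-oneMinusLog^ b isB n ⟩
    sumTo n (λ k → oneMinusLog^ k n)
      ≡⟨ sumTo-cong n (λ k → oneMinusLog^≡altBinomialSum k n) ⟩
    sumTo n (λ k → altBinomialSum k (λ m → stirlingForm m n))
      ≡⟨ sumTo-cong n (λ k → altBinomialSum-cong k (λ m → stirlingForm≡term m n)) ⟩
    sumTo n (λ k → altBinomialSum k (λ m → recip (n !) * term n m))
      ≡⟨ sumTo-cong n (λ k → altBinomialSum-*ˡ k (recip (n !)) (term n)) ⟩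
    sumTo n (λ k → recip (n !) * altBinomialSum k (term n))
      ≡⟨ sumTo-*ˡ n (recip (n !)) (λ k → altBinomialSum k (term n)) ⟨
    firstFormula n ∎
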